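{- Let $\tau$ be a permutation of $[n]$, and let $\mathbf{A}$ be any (possibly empty) composition of the operators $\mathbf{S}$ and $\mathbf{R}$. Let $x,y\in[n]$ be such that no value larger than $\max(x,y)$ occurs between $x$ and $y$ in $\tau$. Then no value larger than $\max(x,y)$ occurs between $x$ and $y$ in $\mathbf{A}(\tau)$.
   Context: - Permutations are written in one-line notation. "Between $x$ and $y$" refers to the entries located strictly between the positions of $x$ and $y$ in the one-line notation. - $\mathbf{S}$ is the stack-sorting operator: $\mathbf{S}(\varepsilon)=\varepsilon$ and $\mathbf{S}(\alpha n\beta)=\mathbf{S}(\alpha)\mathbf{S}(\beta)n$, where $n$ is the maximum entry. Sub-sequences of distinct values are treated as permutations of the values they contain. - $\mathbf{R}$ is reversal. -}

module Defs where

open import Data.Nat using (ℕ; zero; suc; _≤_; _⊔_; _<ᵇ_)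
open import Data.Bool using (true; false)
open import Data.List using (List; []; _∷_; _++_; [_]; length; reverse; applyUpTo)
open import Data.List.Relation.Binary.Permutation.Propositional using (_↭_)
open import Data.List.Relation.Unary.All using (All)
open import Data.Product using (_×_; _,_; Σ; ∃)
open import Relation.Binary.PropositionalEquality using (_≡_)

oneTo : ℕ → List ℕ
oneTo n = applyUpTo suc n

-- τ is a permutation of [n] (one-line notation)
IsPerm : ℕ → List ℕ → Set
IsPerm n τ = τ ↭ oneTo n

splitMax' : ℕ → List ℕ → List ℕ × ℕ × List ℕ
splitMax' m [] = ([] , m , [])
splitMax' m (z ∷ zs) with splitMax' z zs
... | (a , k , b) with m <ᵇ k
...   | true  = (m ∷ a , k , b)
...   | false = ([] , m , z ∷ zs)

-- Stack-sorting with fuel (fuel ≥ length suffices):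
-- S(ε) = ε,  S(α n β) = S(α) S(β) n  with n the maximum entry.
stackSortF : ℕ → List ℕ → List ℕ
stackSortF zero    _        = []
stackSortF (suc f) []       = []
stackSortF (suc f) (m ∷ zs) with splitMax' m zs
... | (α , k , β) = stackSortF f α ++ stackSortF f β ++ [ k ]

S : List ℕ → List ℕ
S τ = stackSortF (length τ) τ

R : List ℕ → List ℕ
R = reverse

data Op : Set where
  opS opR : Op

applyOp : Op → List ℕ → List ℕ
applyOp opS = S
applyOp opR = R

apply : List Op → List ℕ → List ℕ
apply []       τ = τ
apply (o ∷ os) τ = applyOp o (apply os τ)

NoLargerBetween : ℕ → ℕ → List ℕ → Set
NoLargerBetween x y τ =
  ∀ (α γ β : List ℕ) →
    (τ ≡ α ++ x ∷ γ ++ y ∷ β → All (_≤ x ⊔ y) γ) ×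
    (τ ≡ α ++ y ∷ γ ++ x ∷ β → All (_≤ x ⊔ y) γ)

-- Call an entry b "between x and y" in L when x ∷ b ∷ y ∷ [] is a sublist of L.
-- Reversal turns "between x and y" into "between y and x".  For stack-sorting,
-- write L = α k β with k maximal, so S L = S α S β k.  An occurrence x … b … y
-- in S L lies inside S α, inside S β, or has x in S α and y in S β k.  In the
-- first two cases induction applies; in the last, y = k or y ∈ β, and either
-- way k ≤ max(x,y) (k lies between x and y in L), so b ≤ k ≤ max(x,y).
module Submission where

open import Defs
open import Data.Nat using (ℕ; suc; _≤_; _⊔_; _<ᵇ_)
open import Data.Nat.Properties using (≤-refl; ≤-trans; <⇒≤; <ᵇ⇒<; <⇒<ᵇ; ≮⇒≥; m≤m⊔n; m≤n⊔m)
open import Data.Bool using (true; false; T)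
open import Data.List using (List; []; _∷_; _++_; [_]; length; reverse)
open import Data.List.Properties using (++-assoc)
open import Data.List.Relation.Unary.All as All using (All; []; _∷_)
open import Data.List.Relation.Unary.Any using (here; there)
open import Data.List.Membership.Propositional using (_∈_)
open import Data.List.Membership.Propositional.Properties using (∈-++⁺ˡ; ∈-++⁺ʳ; ∈-++⁻; ∈-∃++)
open import Data.List.Relation.Binary.Sublist.Propositional
  using (_⊆_; []; _∷_; _∷ʳ_; ⊆-refl; ⊆-trans; minimum; from∈; to∈; lookup)
open import Data.List.Relation.Binary.Sublist.Propositional.Properties
  using (++⁺; ++⁺ˡ; ++⁺ʳ; reverse⁻)
open import Data.Product using (_×_; _,_; proj₁; proj₂; ∃₂)
open import Data.Sum using (_⊎_; inj₁; inj₂)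
open import Relation.Binary.PropositionalEquality using (_≡_; refl; sym; cong; subst)

⊆-∃++ : ∀ {A : Set} {x : A} {xs L} → x ∷ xs ⊆ L → ∃₂ λ α β → L ≡ α ++ x ∷ β × xs ⊆ β
⊆-∃++ (z ∷ʳ p) with ⊆-∃++ p
... | α , β , refl , q = z ∷ α , β , refl , q
⊆-∃++ (refl ∷ p) = [] , _ , refl , p

⊆-++-split : ∀ {A : Set} (ys : List A) {xs zs} → xs ⊆ ys ++ zs →
  ∃₂ λ xs₁ xs₂ → xs ≡ xs₁ ++ xs₂ × xs₁ ⊆ ys × xs₂ ⊆ zs
⊆-++-split []       p = [] , _ , refl , [] , p
⊆-++-split (y ∷ ys) (y ∷ʳ p) with ⊆-++-split ys p
... | xs₁ , xs₂ , refl , p₁ , p₂ = xs₁ , xs₂ , refl , y ∷ʳ p₁ , p₂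
⊆-++-split (y ∷ ys) (refl ∷ p) with ⊆-++-split ys p
... | xs₁ , xs₂ , refl , p₁ , p₂ = y ∷ xs₁ , xs₂ , refl , refl ∷ p₁ , p₂

triple-⊆-++ : ∀ {A : Set} {x b y : A} L₁ {L₂} → x ∷ b ∷ y ∷ [] ⊆ L₁ ++ L₂ →
  x ∷ b ∷ y ∷ [] ⊆ L₁ ⊎ x ∷ b ∷ y ∷ [] ⊆ L₂ ⊎ (x ∈ L₁ × y ∈ L₂)
triple-⊆-++ L₁ p with ⊆-++-split L₁ p
... | []                , _ , refl , _  , q = inj₂ (inj₁ q)
... | _ ∷ []            , _ , refl , p₁ , q = inj₂ (inj₂ (to∈ p₁ , lookup q (there (here refl))))
... | _ ∷ _ ∷ []        , _ , refl , p₁ , q = inj₂ (inj₂ (lookup p₁ (here refl) , to∈ q))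
... | _ ∷ _ ∷ _ ∷ []    , _ , refl , p₁ , _ = inj₁ p₁
... | _ ∷ _ ∷ _ ∷ _ ∷ _ , _ , () , _

BoundedBetween : ℕ → ℕ → ℕ → List ℕ → Set
BoundedBetween m x y L = ∀ {b} → x ∷ b ∷ y ∷ [] ⊆ L → b ≤ m

boundedBetween-⊆ : ∀ {m x y L L′} → L′ ⊆ L → BoundedBetween m x y L → BoundedBetween m x y L′
boundedBetween-⊆ L′⊆L bnd p = bnd (⊆-trans p L′⊆L)

boundedBetween-reverse : ∀ {m x y} L → BoundedBetween m x y L → BoundedBetween m y x (reverse L)
boundedBetween-reverse L bnd p = bnd (reverse⁻ p)

boundedBetween⁺ : ∀ {m x y} L →
  (∀ α γ β → L ≡ α ++ x ∷ γ ++ y ∷ β → All (_≤ m) γ) → BoundedBetween m x y L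
boundedBetween⁺ {x = x} {y} L h {b} p with ⊆-∃++ p
... | α , _ , refl , p₁ with ⊆-∃++ p₁
... | γ₁ , _ , refl , p₂ with ∈-∃++ (to∈ p₂)
... | γ₂ , β , refl =
  All.lookup (h α (γ₁ ++ b ∷ γ₂) β
                (cong (λ l → α ++ x ∷ l) (sym (++-assoc γ₁ (b ∷ γ₂) (y ∷ β)))))
             (∈-++⁺ʳ γ₁ (here refl))

boundedBetween⁻ : ∀ {m x y} L → BoundedBetween m x y L →
  ∀ α γ β → L ≡ α ++ x ∷ γ ++ y ∷ β → All (_≤ m) γ
boundedBetween⁻ _ bnd α γ β refl =
  All.tabulate λ b∈γ → bnd (++⁺ˡ α (refl ∷ ++⁺ (from∈ b∈γ) (refl ∷ minimum β)))

splitMax'-spec : ∀ m zs → let (α , k , β) = splitMax' m zs in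
  m ∷ zs ≡ α ++ k ∷ β × All (_≤ k) (m ∷ zs)
splitMax'-spec m []       = refl , ≤-refl ∷ []
splitMax'-spec m (z ∷ zs) with splitMax' z zs | splitMax'-spec z zs
... | (α , k , β) | (eq , ≤k) with m <ᵇ k in m<ᵇk
... | true  = cong (m ∷_) eq , <⇒≤ (<ᵇ⇒< m k (subst T (sym m<ᵇk) _)) ∷ ≤k
... | false = refl , ≤-refl ∷ All.map (λ v≤k → ≤-trans v≤k k≤m) ≤k
  where
  k≤m : k ≤ m
  k≤m = ≮⇒≥ (λ m<k → subst T m<ᵇk (<⇒<ᵇ m<k))

module StackStep (s : List ℕ → List ℕ) (∈-s : ∀ {L v} → v ∈ s L → v ∈ L) where

  ∈-step : ∀ α k β {v} → v ∈ s α ++ s β ++ [ k ] → v ∈ α ++ k ∷ β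
  ∈-step α k β v∈ with ∈-++⁻ (s α) v∈
  ... | inj₁ v∈α = ∈-++⁺ˡ (∈-s v∈α)
  ... | inj₂ v∈ with ∈-++⁻ (s β) v∈
  ...   | inj₁ v∈β        = ∈-++⁺ʳ α (there (∈-s v∈β))
  ...   | inj₂ (here refl) = ∈-++⁺ʳ α (here refl)

  ∈-step-≤ : ∀ α k β {v} → All (_≤ k) (α ++ k ∷ β) → v ∈ s α ++ s β ++ [ k ] → v ≤ k
  ∈-step-≤ α k β ≤k v∈ = All.lookup ≤k (∈-step α k β v∈)

  straddling-max-≤ : ∀ {m x y} α k β → y ≤ m → BoundedBetween m x y (α ++ k ∷ β) →
    x ∈ s α → y ∈ s β ++ [ k ] → k ≤ m
  straddling-max-≤ α k β y≤m bnd x∈ y∈ with ∈-++⁻ (s β) y∈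
  ... | inj₁ y∈β        = bnd (++⁺ (from∈ (∈-s x∈)) (refl ∷ from∈ (∈-s y∈β)))
  ... | inj₂ (here refl) = y≤m

  boundedBetween-step : ∀ {m x y} → y ≤ m → (∀ {L} → BoundedBetween m x y L → BoundedBetween m x y (s L)) →
    ∀ α k β → All (_≤ k) (α ++ k ∷ β) →
    BoundedBetween m x y (α ++ k ∷ β) → BoundedBetween m x y (s α ++ s β ++ [ k ])
  boundedBetween-step y≤m bounded-s α k β ≤k bnd p with triple-⊆-++ (s α) p
  ... | inj₁ pα = bounded-s (boundedBetween-⊆ (++⁺ʳ (k ∷ β) ⊆-refl) bnd) pα
  ... | inj₂ (inj₂ (x∈ , y∈)) = ≤-trans (∈-step-≤ α k β ≤k (lookup p (there (here refl))))
                                          (straddling-max-≤ α k β y≤m bnd x∈ y∈)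
  ... | inj₂ (inj₁ q) with triple-⊆-++ (s β) q
  ...   | inj₁ pβ = bounded-s (boundedBetween-⊆ (++⁺ˡ α (k ∷ʳ ⊆-refl)) bnd) pβ
  ...   | inj₂ (inj₁ (_ ∷ʳ ()))
  ...   | inj₂ (inj₁ (refl ∷ ()))
  ...   | inj₂ (inj₂ (_ , here refl)) = ≤-trans (∈-step-≤ α k β ≤k (lookup p (there (here refl)))) y≤m

∈-stackSortF : ∀ f L {v} → v ∈ stackSortF f L → v ∈ L
∈-stackSortF (suc f) (h ∷ zs) {v} v∈ with splitMax' h zs | splitMax'-spec h zs
... | (α , k , β) | (eq , _) =
  subst (v ∈_) (sym eq) (StackStep.∈-step (stackSortF f) (∈-stackSortF f _) α k β v∈)

stackSortF-boundedBetween : ∀ {m x y} → y ≤ m → ∀ f L →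
  BoundedBetween m x y L → BoundedBetween m x y (stackSortF f L)
stackSortF-boundedBetween y≤m (suc f) (h ∷ zs) bnd with splitMax' h zs | splitMax'-spec h zs
... | (α , k , β) | (eq , ≤k) =
  StackStep.boundedBetween-step (stackSortF f) (∈-stackSortF f _) y≤m
    (stackSortF-boundedBetween y≤m f _) α k β
    (subst (All (_≤ k)) eq ≤k) (subst (BoundedBetween _ _ _) eq bnd)

S-boundedBetween : ∀ {m x y} → y ≤ m → ∀ L → BoundedBetween m x y L → BoundedBetween m x y (S L)
S-boundedBetween y≤m L = stackSortF-boundedBetween y≤m (length L) L

apply-boundedBetween : ∀ {m x y} → x ≤ m → y ≤ m → ∀ A τ →
  BoundedBetween m x y τ × BoundedBetween m y x τ →
  BoundedBetween m x y (apply A τ) × BoundedBetween m y x (apply A τ)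
apply-boundedBetween x≤m y≤m []        τ bnds = bnds
apply-boundedBetween x≤m y≤m (opS ∷ A) τ bnds with apply-boundedBetween x≤m y≤m A τ bnds
... | bxy , byx = S-boundedBetween y≤m _ bxy , S-boundedBetween x≤m _ byx
apply-boundedBetween x≤m y≤m (opR ∷ A) τ bnds with apply-boundedBetween x≤m y≤m A τ bnds
... | bxy , byx = boundedBetween-reverse _ byx , boundedBetween-reverse _ bxy

mainTheorem10 : (n : ℕ) (τ : List ℕ) → IsPerm n τ → (A : List Op) → (x y : ℕ) →
    x ∈ τ → y ∈ τ → NoLargerBetween x y τ → NoLargerBetween x y (apply A τ)
mainTheorem10 _ τ _ A x y _ _ noLarger α γ β =
  boundedBetween⁻ _ bxy α γ β , boundedBetween⁻ _ byx α γ β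
  where
  bounded : BoundedBetween (x ⊔ y) x y τ × BoundedBetween (x ⊔ y) y x τ
  bounded = boundedBetween⁺ τ (λ α γ β → proj₁ (noLarger α γ β))
          , boundedBetween⁺ τ (λ α γ β → proj₂ (noLarger α γ β))
  bxy : BoundedBetween (x ⊔ y) x y (apply A τ)
  bxy = proj₁ (apply-boundedBetween (m≤m⊔n x y) (m≤n⊔m x y) A τ bounded)
  byx : BoundedBetween (x ⊔ y) y x (apply A τ)
  byx = proj₂ (apply-boundedBetween (m≤m⊔n x y) (m≤n⊔m x y) A τ bounded)
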